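{- For every integer $n \geq 4$, $x_{n} + x_{n - 3} \geq x_{n - 1} + x_{n - 2}$.
   Context: The sequence $(x_n)_{n\ge1}$ is defined by $x_1 = 0, x_2 = 1, x_3 = 2, x_4 = 4, x_5 = 5$ and, for $n \geq 6$, $$x_n = (n - 1) + \begin{cases} x_{\frac{n + 1}{2}} + x_{\frac{n - 3}{2}}, & n \equiv 1 \pmod 4,\\ 2 x_{\frac{n - 1}{2}}, & n \equiv 3 \pmod 4,\\ x_{\frac{n}{2}} + x_{\frac{n - 2}{2}}, & n \text{ even}. \end{cases}$$ -}

module Defs where

open import Data.Nat using (ℕ; zero; suc; _+_; _*_; _∸_; _/_; _%_)

-- Fuel-indexed evaluation of the recursion; the fuel argument only
-- guarantees termination (each recursive call uses an index strictly
-- smaller than n, so fuel n suffices for index n).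
-- Index 0 is not part of the sequence (which starts at x_1); it is
-- given the dummy value 0 and is never used by the statement.
xAux : ℕ → ℕ → ℕ
xAux zero    _ = 0
xAux (suc f) 0 = 0
xAux (suc f) 1 = 0
xAux (suc f) 2 = 1
xAux (suc f) 3 = 2
xAux (suc f) 4 = 4
xAux (suc f) 5 = 5
xAux (suc f) n@(suc (suc (suc (suc (suc (suc _)))))) with n % 4
... | 1 = (n ∸ 1) + (xAux f ((n + 1) / 2) + xAux f ((n ∸ 3) / 2))
... | 3 = (n ∸ 1) + 2 * xAux f ((n ∸ 1) / 2)
... | _ = (n ∸ 1) + (xAux f (n / 2) + xAux f ((n ∸ 2) / 2))

x : ℕ → ℕ
x n = xAux n n

-- Write d n = x n − x (n − 1).  Comparing the recurrence at four consecutive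
-- indices gives d (4m + 2) = d (4m) and d (4m + 3) = d (4m + 1), while
-- d (4m + 4) − d (4m + 2) = d (2m + 2) − d (2m) and
-- d (4m + 5) − d (4m + 3) = d (2m + 3) − d (2m + 1).  So the inequality
-- d n ≥ d (n − 2) either holds with equality or reduces to the same
-- inequality at roughly half the index; strong induction from the initial
-- values finishes the proof.
module Submission where

open import Data.Nat using (ℕ; zero; suc; _+_; _*_; _∸_; _/_; _%_; _≤_; _<_; _≥_; s≤s; z≤n)
open import Data.Nat.Properties
open import Data.Nat.DivMod using (+-distrib-/-∣ʳ; m*n/n≡m; [m+kn]%n≡m%n; m<n*o⇒m/o<n)
open import Data.Nat.Divisibility using (divides)
open import Data.Nat.Induction using (<-rec)
open import Data.Nat.Tactic.RingSolver using (solve-∀)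
open import Relation.Binary.PropositionalEquality
open import Defs

-- The right-hand side in the definition of xAux, abstracted over the function
-- supplying the earlier values so that the fuel can be exchanged.
recurrence : (ℕ → ℕ) → ℕ → ℕ → ℕ
recurrence y n 1 = (n ∸ 1) + (y ((n + 1) / 2) + y ((n ∸ 3) / 2))
recurrence y n 3 = (n ∸ 1) + 2 * y ((n ∸ 1) / 2)
recurrence y n _ = (n ∸ 1) + (y (n / 2) + y ((n ∸ 2) / 2))

xAux-unfold : ∀ f k → xAux (suc f) (6 + k) ≡ recurrence (xAux f) (6 + k) ((6 + k) % 4)
xAux-unfold f k with (6 + k) % 4
... | 0 = refl
... | 1 = refl
... | 2 = refl
... | 3 = refl
... | suc (suc (suc (suc r))) = refl

half<6+k : ∀ {m} k → m ≤ 7 + k → m / 2 < 6 + k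
half<6+k {m} k m≤7+k = m<n*o⇒m/o<n (s≤s (begin
  m          ≤⟨ m≤7+k ⟩
  7 + k      ≤⟨ +-monoʳ-≤ 7 (m≤m*n k 2) ⟩
  7 + k * 2  ≤⟨ m≤n+m _ 4 ⟩
  11 + k * 2 ∎))
  where open ≤-Reasoning

module _ {y z : ℕ → ℕ} (k : ℕ) (y≗z : ∀ {i} → i < 6 + k → y i ≡ z i) where

  private
    even-cong : (5 + k) + (y ((6 + k) / 2) + y ((4 + k) / 2))
              ≡ (5 + k) + (z ((6 + k) / 2) + z ((4 + k) / 2))
    even-cong = cong ((5 + k) +_) (cong₂ _+_
      (y≗z (half<6+k k (m≤n+m _ 1))) (y≗z (half<6+k k (m≤n+m _ 3))))

  recurrence-cong : ∀ r → recurrence y (6 + k) r ≡ recurrence z (6 + k) r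
  recurrence-cong 1 = cong ((5 + k) +_) (cong₂ _+_
    (y≗z (half<6+k k (≤-reflexive (+-comm (6 + k) 1)))) (y≗z (half<6+k k (m≤n+m _ 4))))
  recurrence-cong 3 = cong (λ v → (5 + k) + 2 * v) (y≗z (half<6+k k (m≤n+m _ 2)))
  recurrence-cong 0 = even-cong
  recurrence-cong 2 = even-cong
  recurrence-cong (suc (suc (suc (suc r)))) = even-cong

xAux-fuel : ∀ {f g} n → n ≤ f → n ≤ g → xAux f n ≡ xAux g n
xAux-fuel {zero}  {zero}  _ _ _ = refl
xAux-fuel {zero}  {suc _} zero _ _ = refl
xAux-fuel {suc _} {zero}  zero _ _ = refl
xAux-fuel {suc _} {suc _} 0 _ _ = refl
xAux-fuel {suc _} {suc _} 1 _ _ = refl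
xAux-fuel {suc _} {suc _} 2 _ _ = refl
xAux-fuel {suc _} {suc _} 3 _ _ = refl
xAux-fuel {suc _} {suc _} 4 _ _ = refl
xAux-fuel {suc _} {suc _} 5 _ _ = refl
xAux-fuel {suc f} {suc g} (suc (suc (suc (suc (suc (suc k)))))) n≤1+f n≤1+g = begin
  xAux (suc f) (6 + k)                            ≡⟨ xAux-unfold f k ⟩
  recurrence (xAux f) (6 + k) ((6 + k) % 4)       ≡⟨ recurrence-cong k earlier ((6 + k) % 4) ⟩
  recurrence (xAux g) (6 + k) ((6 + k) % 4)       ≡⟨ sym (xAux-unfold g k) ⟩
  xAux (suc g) (6 + k)                            ∎
  where
  open ≡-Reasoning
  earlier : ∀ {i} → i < 6 + k → xAux f i ≡ xAux g i
  earlier i<n = xAux-fuel _ (≤-pred (≤-trans i<n n≤1+f)) (≤-pred (≤-trans i<n n≤1+g))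

x-unfold : ∀ k → x (6 + k) ≡ recurrence x (6 + k) ((6 + k) % 4)
x-unfold k = trans (xAux-unfold (5 + k) k)
  (recurrence-cong k (λ i<n → xAux-fuel _ (≤-pred i<n) ≤-refl) ((6 + k) % 4))

x-unfold-mod4 : ∀ c q → x (6 + (c + q * 4)) ≡ recurrence x (6 + (c + q * 4)) ((6 + c) % 4)
x-unfold-mod4 c q = trans (x-unfold (c + q * 4)) (cong (recurrence x _)
  (trans (cong (_% 4) (sym (+-assoc 6 c (q * 4)))) ([m+kn]%n≡m%n (6 + c) q 4)))

[m+q*4]/2 : ∀ m q → (m + q * 4) / 2 ≡ m / 2 + q * 2
[m+q*4]/2 m q = begin
  (m + q * 4) / 2        ≡⟨ +-distrib-/-∣ʳ m (divides (q * 2) (sym (*-assoc q 2 2))) ⟩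
  m / 2 + q * 4 / 2      ≡⟨ cong (λ n → m / 2 + n / 2) (sym (*-assoc q 2 2)) ⟩
  m / 2 + q * 2 * 2 / 2  ≡⟨ cong (m / 2 +_) (m*n/n≡m (q * 2) 2) ⟩
  m / 2 + q * 2          ∎
  where open ≡-Reasoning

x[4q+6] : ∀ q → x (6 + q * 4) ≡ (5 + q * 4) + (x (3 + q * 2) + x (2 + q * 2))
x[4q+6] q = trans (x-unfold-mod4 0 q)
  (cong ((5 + q * 4) +_) (cong₂ _+_ (cong x ([m+q*4]/2 6 q)) (cong x ([m+q*4]/2 4 q))))

x[4q+7] : ∀ q → x (7 + q * 4) ≡ (6 + q * 4) + 2 * x (3 + q * 2)
x[4q+7] q = trans (x-unfold-mod4 1 q)
  (cong (λ v → (6 + q * 4) + 2 * x v) ([m+q*4]/2 6 q))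

x[4q+8] : ∀ q → x (8 + q * 4) ≡ (7 + q * 4) + (x (4 + q * 2) + x (3 + q * 2))
x[4q+8] q = trans (x-unfold-mod4 2 q)
  (cong ((7 + q * 4) +_) (cong₂ _+_ (cong x ([m+q*4]/2 8 q)) (cong x ([m+q*4]/2 6 q))))

x[4q+9] : ∀ q → x (9 + q * 4) ≡ (8 + q * 4) + (x (5 + q * 2) + x (3 + q * 2))
x[4q+9] q = trans (x-unfold-mod4 3 q)
  (cong ((8 + q * 4) +_) (cong₂ _+_
    (cong x (trans (cong (_/ 2) (+-comm (9 + q * 4) 1)) ([m+q*4]/2 10 q)))
    (cong x ([m+q*4]/2 6 q))))

GapGrows : ℕ → Set
GapGrows k = x (3 + k) + x (2 + k) ≤ x (4 + k) + x (1 + k)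

gapGrows-5+4q : ∀ q → GapGrows (1 + q * 2) → GapGrows (5 + q * 4)
gapGrows-5+4q q ih = begin
  x (8 + q * 4) + x (7 + q * 4)            ≡⟨ cong₂ _+_ (x[4q+8] q) (x[4q+7] q) ⟩
  (7 + t + (b + c)) + (6 + t + 2 * c)      ≡⟨ regroupˡ t b c ⟩
  s + (b + c)                              ≤⟨ +-monoʳ-≤ s ih ⟩
  s + (a + d)                              ≡⟨ regroupʳ t a c d ⟩
  (8 + t + (a + c)) + (5 + t + (c + d))    ≡⟨ sym (cong₂ _+_ (x[4q+9] q) (x[4q+6] q)) ⟩
  x (9 + q * 4) + x (6 + q * 4)            ∎
  where
  open ≤-Reasoning
  t a b c d s : ℕ
  t = q * 4
  a = x (5 + q * 2)
  b = x (4 + q * 2)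
  c = x (3 + q * 2)
  d = x (2 + q * 2)
  s = 13 + t + t + 2 * c
  regroupˡ : ∀ t b c → (7 + t + (b + c)) + (6 + t + 2 * c) ≡ (13 + t + t + 2 * c) + (b + c)
  regroupˡ = solve-∀
  regroupʳ : ∀ t a c d → (13 + t + t + 2 * c) + (a + d) ≡ (8 + t + (a + c)) + (5 + t + (c + d))
  regroupʳ = solve-∀

gapGrows-6+4q : ∀ q → GapGrows (6 + q * 4)
gapGrows-6+4q q = ≤-reflexive (begin
  x (9 + q * 4) + x (8 + q * 4)            ≡⟨ cong₂ _+_ (x[4q+9] q) (x[4q+8] q) ⟩
  (8 + t + (a + c)) + (7 + t + (b + c))    ≡⟨ regroup t a b c ⟩
  (9 + t + (a + b)) + (6 + t + 2 * c)      ≡⟨ sym (cong₂ _+_ (x[4q+6] (suc q)) (x[4q+7] q)) ⟩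
  x (10 + q * 4) + x (7 + q * 4)           ∎)
  where
  open ≡-Reasoning
  t a b c : ℕ
  t = q * 4
  a = x (5 + q * 2)
  b = x (4 + q * 2)
  c = x (3 + q * 2)
  regroup : ∀ t a b c → (8 + t + (a + c)) + (7 + t + (b + c)) ≡ (9 + t + (a + b)) + (6 + t + 2 * c)
  regroup = solve-∀

gapGrows-7+4q : ∀ q → GapGrows (7 + q * 4)
gapGrows-7+4q q = ≤-reflexive (begin
  x (10 + q * 4) + x (9 + q * 4)           ≡⟨ cong₂ _+_ (x[4q+6] (suc q)) (x[4q+9] q) ⟩
  (9 + t + (a + b)) + (8 + t + (a + c))    ≡⟨ regroup t a b c ⟩
  (10 + t + 2 * a) + (7 + t + (b + c))     ≡⟨ sym (cong₂ _+_ (x[4q+7] (suc q)) (x[4q+8] q)) ⟩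
  x (11 + q * 4) + x (8 + q * 4)           ∎)
  where
  open ≡-Reasoning
  t a b c : ℕ
  t = q * 4
  a = x (5 + q * 2)
  b = x (4 + q * 2)
  c = x (3 + q * 2)
  regroup : ∀ t a b c → (9 + t + (a + b)) + (8 + t + (a + c)) ≡ (10 + t + 2 * a) + (7 + t + (b + c))
  regroup = solve-∀

gapGrows-8+4q : ∀ q → GapGrows (2 + q * 2) → GapGrows (8 + q * 4)
gapGrows-8+4q q ih = begin
  x (11 + q * 4) + x (10 + q * 4)          ≡⟨ cong₂ _+_ (x[4q+7] (suc q)) (x[4q+6] (suc q)) ⟩
  (10 + t + 2 * a) + (9 + t + (a + b))     ≡⟨ regroupˡ t a b ⟩
  s + (a + b)                              ≤⟨ +-monoʳ-≤ s ih ⟩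
  s + (e + c)                              ≡⟨ regroupʳ t a c e ⟩
  (11 + t + (e + a)) + (8 + t + (a + c))   ≡⟨ sym (cong₂ _+_ (x[4q+8] (suc q)) (x[4q+9] q)) ⟩
  x (12 + q * 4) + x (9 + q * 4)           ∎
  where
  open ≤-Reasoning
  t a b c e s : ℕ
  t = q * 4
  a = x (5 + q * 2)
  b = x (4 + q * 2)
  c = x (3 + q * 2)
  e = x (6 + q * 2)
  s = 19 + t + t + 2 * a
  regroupˡ : ∀ t a b → (10 + t + 2 * a) + (9 + t + (a + b)) ≡ (19 + t + t + 2 * a) + (a + b)
  regroupˡ = solve-∀
  regroupʳ : ∀ t a c e → (19 + t + t + 2 * a) + (e + c) ≡ (11 + t + (e + a)) + (8 + t + (a + c))
  regroupʳ = solve-∀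

data Mod4 : ℕ → Set where
  rem0 : ∀ q → Mod4 (q * 4)
  rem1 : ∀ q → Mod4 (1 + q * 4)
  rem2 : ∀ q → Mod4 (2 + q * 4)
  rem3 : ∀ q → Mod4 (3 + q * 4)

mod4 : ∀ n → Mod4 n
mod4 0 = rem0 0
mod4 1 = rem1 0
mod4 2 = rem2 0
mod4 3 = rem3 0
mod4 (suc (suc (suc (suc n)))) with mod4 n
... | rem0 q = rem0 (suc q)
... | rem1 q = rem1 (suc q)
... | rem2 q = rem2 (suc q)
... | rem3 q = rem3 (suc q)

c+q*2<d+q*4 : ∀ {c d} q → c < d → c + q * 2 < d + q * 4
c+q*2<d+q*4 q c<d = +-mono-<-≤ c<d (*-monoʳ-≤ q (s≤s (s≤s z≤n)))

gapGrows : ∀ k → GapGrows k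
gapGrows = <-rec GapGrows step
  where
  step : ∀ k → (∀ {j} → j < k → GapGrows j) → GapGrows k
  step 0 _ = n≤1+n _
  step 1 _ = ≤-refl
  step 2 _ = n≤1+n _
  step 3 _ = n≤1+n _
  step 4 _ = ≤-refl
  step (suc (suc (suc (suc (suc j))))) ih with mod4 j
  ... | rem0 q = gapGrows-5+4q q (ih (c+q*2<d+q*4 q (s≤s (s≤s z≤n))))
  ... | rem1 q = gapGrows-6+4q q
  ... | rem2 q = gapGrows-7+4q q
  ... | rem3 q = gapGrows-8+4q q (ih (c+q*2<d+q*4 q (s≤s (s≤s (s≤s z≤n)))))

corollary1 : (n : ℕ) → n ≥ 4 → x n + x (n ∸ 3) ≥ x (n ∸ 1) + x (n ∸ 2)
corollary1 (suc (suc (suc (suc k)))) _ = gapGrows k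
corollary1 (suc (suc (suc zero))) (s≤s (s≤s (s≤s ())))
corollary1 (suc (suc zero)) (s≤s (s≤s ()))
corollary1 (suc zero) (s≤s ())
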